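{- Let $f:\widetilde{G}\to G$ be a homotopy covering map, let $K$ be a graph, and let $\varphi,\psi:K\to G$ be graph morphisms that are homotopic via a morphism $H:K\times I_n\to G$ with $H(k,0)=\varphi(k)$ and $H(k,n)=\psi(k)$ for all vertices $k$ of $K$. Suppose $\widetilde{\varphi}:K\to\widetilde{G}$ is a graph morphism with $f\circ\widetilde{\varphi}=\varphi$. Then there is a graph morphism $\widetilde{H}:K\times I_n\to\widetilde{G}$ with $\widetilde{H}(k,0)=\widetilde{\varphi}(k)$ for all $k$ and $f\circ\widetilde{H}=H$. In particular $\widetilde{\psi}:=\widetilde{H}(-,n)$ is a lift of $\psi$ (i.e. $f\circ\widetilde\psi=\psi$) with $\widetilde{\varphi}\simeq\widetilde{\psi}$.
   Context: All graphs are undirected, have no multiple edges, may have loops (a vertex adjacent to itself), are connected, and are not a single isolated vertex (every vertex is adjacent to at least one vertex, possibly itself). Adjacency is written $x\sim y$ and $N(v)$ denotes the set of vertices adjacent to $v$. A graph morphism $f:G\to H$ is a map on vertices with $f(x)\sim f(y)$ whenever $x\sim y$. A walk of length $n$ is a sequence $(v_0v_1\cdots v_n)$ of vertices with $v_i\sim v_{i+1}$ for all $i$; $N_2(v)$ denotes the set of walks of length $2$ starting at $v$. A homotopy covering map is a graph morphism $f:\widetilde G\to G$ such that for every vertex $\tilde v$ of $\widetilde G$, applying $f$ vertexwise gives a bijection $N_2(\tilde v)\to N_2(f(\tilde v))$ which respects endpoints: two walks in $N_2(\tilde v)$ have the same final vertex if and only if their images in $N_2(f(\tilde v))$ have the same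 final vertex. The categorical product $K\times I_n$ has vertices the pairs $(k,i)$, with $(k,i)\sim(k',i')$ iff $k\sim k'$ in $K$ and $i\sim i'$ in $I_n$, where $I_n$ is the looped path graph with vertices $0,1,\dots,n$, edges $i\sim i+1$, and a loop $i\sim i$ at every vertex. Two morphisms $\varphi,\psi:K\to G$ are homotopic, written $\varphi\simeq\psi$, if there is a morphism $H:K\times I_n\to G$ for some $n$ with $H(-,0)=\varphi$ and $H(-,n)=\psi$. -}

module Defs where

open import Data.Nat using (ℕ; suc)
open import Data.Fin using (Fin; toℕ; zero; fromℕ)
open import Data.Product using (Σ; _×_; _,_; proj₁; proj₂; ∃-syntax)
open import Relation.Binary.PropositionalEquality using (_≡_)
open import Function.Definitions using (Bijective)
open import Function.Bundles using (_⇔_)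

data Reach {V : Set} (_∼_ : V → V → Set) : V → V → Set where
  here : ∀ {x} → Reach _∼_ x x
  step : ∀ {x y z} → x ∼ y → Reach _∼_ y z → Reach _∼_ x z

-- A graph: undirected (symmetric adjacency), no multiple edges (adjacency is
-- a proposition), loops allowed, connected, no isolated vertex.
record Graph : Set₁ where
  field
    V     : Set
    _∼_   : V → V → Set
    ∼-sym : ∀ {x y} → x ∼ y → y ∼ x
    ∼-prop : ∀ {x y} (p q : x ∼ y) → p ≡ q
    connected : ∀ x y → Reach _∼_ x y
    nonIsolated : ∀ x → Σ V (λ y → x ∼ y)

open Graph public

record Hom (G H : Graph) : Set where
  field
    map  : V G → V H
    pres : ∀ {x y} → _∼_ G x y → _∼_ H (map x) (map y)

open Hom public

N₂ : (G : Graph) → V G → Set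
N₂ G v = Σ (V G) λ a → Σ (V G) λ b → _∼_ G v a × _∼_ G a b

end₂ : {G : Graph} {v : V G} → N₂ G v → V G
end₂ (a , b , _) = b

mapN₂ : {G H : Graph} (f : Hom G H) (v : V G) → N₂ G v → N₂ H (map f v)
mapN₂ f v (a , b , p , q) = map f a , map f b , pres f p , pres f q

record IsHomotopyCovering {G̃ G : Graph} (f : Hom G̃ G) : Set where
  field
    bij : ∀ ṽ → Bijective _≡_ _≡_ (mapN₂ f ṽ)
    endpoints : ∀ ṽ (w w′ : N₂ G̃ ṽ) →
      (end₂ {G̃} w ≡ end₂ {G̃} w′) ⇔ (end₂ {G} (mapN₂ f ṽ w) ≡ end₂ {G} (mapN₂ f ṽ w′))

data _∼I_ {n : ℕ} : Fin (suc n) → Fin (suc n) → Set where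
  loop : ∀ {i : Fin (suc n)} → i ∼I i
  up   : ∀ {i j : Fin (suc n)} → toℕ j ≡ suc (toℕ i) → i ∼I j
  down : ∀ {i j : Fin (suc n)} → toℕ i ≡ suc (toℕ j) → i ∼I j

-- a morphism K × I_n → G, written out on pairs (k , i)
record ProdHom (K : Graph) (n : ℕ) (G : Graph) : Set where
  field
    hmap  : V K → Fin (suc n) → V G
    hpres : ∀ {k k′ i i′} → _∼_ K k k′ → i ∼I i′ →
            _∼_ G (hmap k i) (hmap k′ i′)

open ProdHom public

Homotopic : {K G : Graph} → Hom K G → Hom K G → Set
Homotopic {K} {G} φ ψ = Σ ℕ λ m → Σ (ProdHom K m G) λ H →
  (∀ k → hmap H k zero ≡ map φ k) × (∀ k → hmap H k (fromℕ m) ≡ map ψ k)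

module Submission where

open import Defs
open import Data.Nat using (ℕ; zero; suc)
open import Data.Fin using (Fin; zero; suc; fromℕ; toℕ)
open import Data.Product using (Σ; _×_; _,_; proj₁; proj₂)
open import Relation.Binary.PropositionalEquality using (_≡_; refl; sym; trans; cong; subst; subst₂)
open import Function.Bundles using (Equivalence)

-- Extend H to K × ℕ by clamping and build the lift one level at a time: above a
-- lift x̃ of H(k,m), pick a neighbour c of k; the walk H(k,m) ∼ H(c,m) ∼ H(k,m+1)
-- lifts uniquely from x̃ (bijectivity on N₂), and its endpoint lifts H(k,m+1).
-- Edges of K × I_n lift to edges because, in a homotopy covering, two length-2
-- walks from the same vertex whose endpoints have the same image have the same
-- endpoint; so any lift of an edge lands exactly on the vertex already chosen,
-- and the choice of c is irrelevant.

suc-∼I : ∀ {n} {i j : Fin (suc n)} → i ∼I j → suc i ∼I suc j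
suc-∼I loop     = loop
suc-∼I (up e)   = up (cong suc e)
suc-∼I (down e) = down (cong suc e)

clamp : (n : ℕ) → ℕ → Fin (suc n)
clamp n       zero    = zero
clamp zero    (suc m) = zero
clamp (suc n) (suc m) = suc (clamp n m)

clamp-toℕ : ∀ {n} (i : Fin (suc n)) → clamp n (toℕ i) ≡ i
clamp-toℕ         zero    = refl
clamp-toℕ {suc n} (suc i) = cong suc (clamp-toℕ i)

clamp-suc-∼I : ∀ n m → clamp n m ∼I clamp n (suc m)
clamp-suc-∼I zero    zero    = loop
clamp-suc-∼I zero    (suc m) = loop
clamp-suc-∼I (suc n) zero    = up refl
clamp-suc-∼I (suc n) (suc m) = suc-∼I (clamp-suc-∼I n m)

-- A morphism K × I_∞ → G, where I_∞ is the looped path on ℕ; the edges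
-- (k , m + 1) ∼ (k′ , m) are covered by symmetry.
record ProdRayHom (K G : Graph) : Set where
  field
    rmap    : V K → ℕ → V G
    stay    : ∀ {k k′ m} → _∼_ K k k′ → _∼_ G (rmap k m) (rmap k′ m)
    advance : ∀ {k k′ m} → _∼_ K k k′ → _∼_ G (rmap k m) (rmap k′ (suc m))

open ProdRayHom public

extend : ∀ {K G n} → ProdHom K n G → ProdRayHom K G
extend {n = n} H = record
  { rmap    = λ k m → hmap H k (clamp n m)
  ; stay    = λ e → hpres H e loop
  ; advance = λ {_} {_} {m} e → hpres H e (clamp-suc-∼I n m)
  }

restrict : ∀ {K G} n → ProdRayHom K G → ProdHom K n G
restrict {K} {G} n H = record { hmap = λ k i → rmap H k (toℕ i) ; hpres = restricted-pres }
  where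
  restricted-pres : ∀ {k k′} {i i′ : Fin (suc n)} → _∼_ K k k′ → i ∼I i′ →
                    _∼_ G (rmap H k (toℕ i)) (rmap H k′ (toℕ i′))
  restricted-pres e loop                          = stay H e
  restricted-pres e (up i′≡1+i)   rewrite i′≡1+i = advance H e
  restricted-pres e (down i≡1+i′) rewrite i≡1+i′ = ∼-sym G (advance H (∼-sym K e))

restrict-extend : ∀ {K G n} (H : ProdHom K n G) k i →
                  hmap (restrict n (extend H)) k i ≡ hmap H k i
restrict-extend H k i = cong (hmap H k) (clamp-toℕ i)

slice : ∀ {K G n} → ProdHom K n G → Fin (suc n) → Hom K G
slice H i = record { map = λ k → hmap H k i ; pres = λ e → hpres H e loop }

module HomotopyCovering {G̃ G : Graph} (f : Hom G̃ G) (cov : IsHomotopyCovering f) where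

  open IsHomotopyCovering cov
  open Graph G̃ using () renaming (_∼_ to _∼̃_; ∼-sym to ∼̃-sym)
  open Graph G using () renaming (_∼_ to _∼ᴳ_; ∼-sym to ∼ᴳ-sym)

  Walk₂ : V G̃ → V G̃ → Set
  Walk₂ x y = Σ (V G̃) λ a → x ∼̃ a × a ∼̃ y

  lift-walk₂ : ∀ x (w : N₂ G (map f x)) → Σ (N₂ G̃ x) λ w̃ → mapN₂ f x w̃ ≡ w
  lift-walk₂ x w with proj₂ (bij x) w
  ... | w̃ , lifts = w̃ , lifts refl

  walk₂-end-unique : ∀ {x y y′} → Walk₂ x y → Walk₂ x y′ → map f y ≡ map f y′ → y ≡ y′
  walk₂-end-unique {x} {y} {y′} (a , xa , ay) (a′ , xa′ , a′y′) =
    Equivalence.from (endpoints x (a , y , xa , ay) (a′ , y′ , xa′ , a′y′))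

  lift-walk₂-end : ∀ x {a b} → map f x ∼ᴳ a → a ∼ᴳ b →
                   Σ (V G̃) λ y → Walk₂ x y × map f y ≡ b
  lift-walk₂-end x xa ab with lift-walk₂ x (_ , _ , xa , ab)
  ... | (ã , b̃ , xã , ãb̃) , lifts =
    b̃ , (ã , xã , ãb̃) , cong (λ w → proj₁ (proj₂ w)) lifts

  -- Lift the edge f x ∼ f y (as the walk f x ∼ f y ∼ f x) from x; prefixing the
  -- edge x′ ∼ x turns it into a 2-walk from x′ ending above f y, hence at y.
  walk₂-end-adjacent : ∀ {x′ x y} → x′ ∼̃ x → Walk₂ x′ y → map f x ∼ᴳ map f y → x ∼̃ y
  walk₂-end-adjacent {x′} {x} {y} x′x x′⇝y fxfy with lift-walk₂ x (_ , _ , fxfy , ∼ᴳ-sym fxfy)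
  ... | (ỹ , _ , xỹ , _) , lifts =
    subst (x ∼̃_) (walk₂-end-unique (x , x′x , xỹ) x′⇝y (cong proj₁ lifts)) xỹ

  module RayLift {K : Graph} (H : ProdRayHom K G) (φ̃ : Hom K G̃)
                 (base : ∀ k → map f (map φ̃ k) ≡ rmap H k zero) where

    open Graph K using () renaming (∼-sym to ∼K-sym)

    lift-step : ∀ k m x → map f x ≡ rmap H k m →
                Σ (V G̃) λ y → Walk₂ x y × map f y ≡ rmap H k (suc m)
    lift-step k m x fx with nonIsolated K k
    ... | c , kc = lift-walk₂-end x (subst (_∼ᴳ rmap H c m) (sym fx) (stay H kc))
                                    (advance H (∼K-sym kc))

    lift : V K → ℕ → V G̃
    lift-over : ∀ k m → map f (lift k m) ≡ rmap H k m

    lift k zero    = map φ̃ k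
    lift k (suc m) = proj₁ (lift-step k m (lift k m) (lift-over k m))

    lift-over k zero    = base k
    lift-over k (suc m) = proj₂ (proj₂ (lift-step k m (lift k m) (lift-over k m)))

    lift-walk : ∀ k m → Walk₂ (lift k m) (lift k (suc m))
    lift-walk k m = proj₁ (proj₂ (lift-step k m (lift k m) (lift-over k m)))

    pull-edge : ∀ {k m k′ m′} → rmap H k m ∼ᴳ rmap H k′ m′ →
                map f (lift k m) ∼ᴳ map f (lift k′ m′)
    pull-edge {k} {m} {k′} {m′} = subst₂ _∼ᴳ_ (sym (lift-over k m)) (sym (lift-over k′ m′))

    lift-stay    : ∀ m {k k′} → _∼_ K k k′ → lift k m ∼̃ lift k′ m
    lift-advance : ∀ m {k k′} → _∼_ K k k′ → lift k m ∼̃ lift k′ (suc m)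

    lift-stay zero    e = pres φ̃ e
    lift-stay (suc m) {k} e =
      ∼̃-sym (walk₂-end-adjacent (lift-advance m e) (lift-walk k m)
                                (pull-edge (stay H {m = suc m} (∼K-sym e))))

    lift-advance m {k} {k′} e =
      walk₂-end-adjacent (lift-stay m (∼K-sym e)) (lift-walk k′ m) (pull-edge (advance H {m = m} e))

    lifted : ProdRayHom K G̃
    lifted = record
      { rmap = lift ; stay = λ {_} {_} {m} → lift-stay m ; advance = λ {_} {_} {m} → lift-advance m }

theorem3p9 : {G̃ G K : Graph} (f : Hom G̃ G) → IsHomotopyCovering f →
    (n : ℕ) (φ ψ : Hom K G) (H : ProdHom K n G) →
    (∀ k → hmap H k zero ≡ map φ k) → (∀ k → hmap H k (fromℕ n) ≡ map ψ k) →
    (φ̃ : Hom K G̃) → (∀ k → map f (map φ̃ k) ≡ map φ k) →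
    Σ (ProdHom K n G̃) λ H̃ →
      (∀ k → hmap H̃ k zero ≡ map φ̃ k)
      × (∀ k i → map f (hmap H̃ k i) ≡ hmap H k i)
      × Σ (Hom K G̃) λ ψ̃ →
          (∀ k → map ψ̃ k ≡ hmap H̃ k (fromℕ n))
          × (∀ k → map f (map ψ̃ k) ≡ map ψ k)
          × Homotopic φ̃ ψ̃
theorem3p9 {G̃} {G} {K} f cov n φ ψ H Hφ Hψ φ̃ fφ̃ =
  H̃ , H̃-starts , H̃-over , slice H̃ (fromℕ n) , (λ _ → refl) , ψ̃-over
    , n , H̃ , H̃-starts , (λ _ → refl)
  where
  open HomotopyCovering f cov
  open RayLift (extend H) φ̃ (λ k → trans (fφ̃ k) (sym (Hφ k)))

  H̃ : ProdHom K n G̃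
  H̃ = restrict n lifted

  H̃-starts : ∀ k → hmap H̃ k zero ≡ map φ̃ k
  H̃-starts _ = refl

  H̃-over : ∀ k i → map f (hmap H̃ k i) ≡ hmap H k i
  H̃-over k i = trans (lift-over k (toℕ i)) (restrict-extend H k i)

  ψ̃-over : ∀ k → map f (hmap H̃ k (fromℕ n)) ≡ map ψ k
  ψ̃-over k = trans (H̃-over k (fromℕ n)) (Hψ k)
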